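{- Let $f\colon\mathbb F_2^n\to\mathbb F_2$ be an affine $\delta$-extractor of dimension at least $d$. Then $R^{lin}_\delta(f)\ge n-d+1$.
   Context: $f$ is an affine $\delta$-extractor of dimension at least $d$ if for every affine subspace $A$ of $\mathbb F_2^n$ of dimension at least $d$, $\min_{z\in\{0,1\}}\Pr_{x\sim U(A)}[f(x)=z]>\delta$. $R^{lin}_\delta(f)$ is the smallest $k$ such that there exist a probability distribution over $k$-tuples $(s_1,\dots,s_k)$ of vectors in $\mathbb F_2^n$ and a function $g\colon\mathbb F_2^k\to\mathbb F_2$ with $\Pr[g(s_1\cdot x,\dots,s_k\cdot x)=f(x)]\ge1-\delta$ for every $x\in\mathbb F_2^n$, where $s\cdot x=\sum_is_ix_i$ over $\mathbb F_2$.
   Formalization: The parameter δ and the probabilities of the distribution over k-tuples $(s_1,\dots,s_k)$ are rational. -}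

module Defs where

open import Data.Bool using (Bool; true; false; _∧_; _xor_; if_then_else_)
open import Data.Bool.Properties using (_≟_)
open import Data.Nat as ℕ using (ℕ; zero; suc; _^_)
open import Data.Nat.Properties using (m^n≢0)
open import Data.Integer using (+_)
open import Data.Rational using (ℚ; _/_; _+_; _-_; _<_; _≤_; 0ℚ; 1ℚ)
open import Data.List using (List; []; _∷_; map; concatMap; length; filter; foldr)
open import Data.Vec using (Vec; []; _∷_; zipWith; replicate)
open import Data.Product using (_×_; _,_; proj₁; proj₂; Σ; ∃-syntax)
open import Relation.Binary.PropositionalEquality using (_≡_)
open import Relation.Nullary using (¬_)

-- F₂^n is represented as Vec Bool n (false = 0, true = 1; addition = xor).
F2^ : ℕ → Set
F2^ n = Vec Bool n

_⊕_ : ∀ {n} → F2^ n → F2^ n → F2^ n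
_⊕_ = zipWith _xor_

zeroV : ∀ n → F2^ n
zeroV n = replicate n false

dot : ∀ {n} → F2^ n → F2^ n → Bool
dot [] [] = false
dot (s ∷ ss) (x ∷ xs) = (s ∧ x) xor dot ss xs

allVecs : (m : ℕ) → List (F2^ m)
allVecs zero = [] ∷ []
allVecs (suc m) = concatMap (λ v → (false ∷ v) ∷ (true ∷ v) ∷ []) (allVecs m)

lincomb : ∀ {n m} → F2^ m → Vec (F2^ n) m → F2^ n
lincomb {n} [] [] = zeroV n
lincomb (c ∷ cs) (v ∷ vs) = (if c then v else zeroV _) ⊕ lincomb cs vs

LinIndep : ∀ {n m} → Vec (F2^ n) m → Set
LinIndep {n} {m} vs = ∀ (c : F2^ m) → lincomb c vs ≡ zeroV n → c ≡ zeroV m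

-- An affine subspace of F₂^n of dimension m: a + span(v₁,…,vₘ) with v's independent.
-- Its points are exactly  a ⊕ lincomb c vs  for c ∈ F₂^m, each hit once.
record AffineSubspace (n m : ℕ) : Set where
  constructor affine
  field
    base  : F2^ n
    basis : Vec (F2^ n) m
    indep : LinIndep basis

  point : F2^ m → F2^ n
  point c = base ⊕ lincomb c basis

prUniform : ∀ {n m} → AffineSubspace n m → (F2^ n → Bool) → Bool → ℚ
prUniform {n} {m} A f z =
  _/_ (+ length (filter (λ c → f (AffineSubspace.point A c) ≟ z) (allVecs m)))
      (2 ^ m) {{m^n≢0 2 m}}

AffineExtractor : ∀ {n} → ℚ → ℕ → (F2^ n → Bool) → Set
AffineExtractor {n} δ d f =
  ∀ (m : ℕ) → d ℕ.≤ m → (A : AffineSubspace n m) →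
    (z : Bool) → δ < prUniform A f z

-- A finitely supported probability distribution on k-tuples of vectors of F₂^n:
-- a list of (weight, tuple) pairs, weights nonnegative and summing to 1.
WeightedList : ℕ → ℕ → Set
WeightedList n k = List (ℚ × Vec (F2^ n) k)

totalWeight : ∀ {A : Set} → List (ℚ × A) → ℚ
totalWeight = foldr (λ p r → proj₁ p + r) 0ℚ

data AllNonneg {A : Set} : List (ℚ × A) → Set where
  []  : AllNonneg []
  _∷_ : ∀ {w a ps} → 0ℚ ≤ w → AllNonneg ps → AllNonneg ((w , a) ∷ ps)

record Distribution (n k : ℕ) : Set where
  constructor distr
  field
    support  : WeightedList n k
    nonneg   : AllNonneg support
    sumToOne : totalWeight support ≡ 1ℚ

queries : ∀ {n k} → Vec (F2^ n) k → F2^ n → F2^ k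
queries [] x = []
queries (s ∷ ss) x = dot s x ∷ queries ss x

successProb : ∀ {n k} → Distribution n k → (F2^ k → Bool) → (F2^ n → Bool) → F2^ n → ℚ
successProb D g f x =
  totalWeight (filter (λ p → g (queries (proj₂ p) x) ≟ f x) (Distribution.support D))

HasLinProtocol : ∀ {n} → ℚ → (F2^ n → Bool) → ℕ → Set
HasLinProtocol {n} δ f k =
  Σ (Distribution n k) λ D → Σ (F2^ k → Bool) λ g →
    ∀ (x : F2^ n) → 1ℚ - δ ≤ successProb D g f x

-- Suppose a protocol makes k ≤ n − d queries. For each query tuple s the common kernel of
-- s₁, …, s_k contains a d-dimensional subspace K, and the answer g(s₁·x, …, s_k·x) is constant
-- on every coset x + K. On each coset f disagrees with that constant on more than a δ-fraction
-- of the points, so a fixed tuple s errs on more than δ·2ⁿ inputs. Averaging over s, the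
-- expected number of errors exceeds δ·2ⁿ, whereas correctness with probability 1 − δ at every
-- input bounds it by δ·2ⁿ.

module Submission where

open import Defs
open import Algebra.Bundles using (CommutativeMonoid; CommutativeRing)
open import Data.Bool using (Bool; true; false; not; _∧_; _xor_; if_then_else_)
open import Data.Bool.Properties
  using (_≟_; xor-same; xor-comm; xor-identityʳ; ∧-distribˡ-xor; ∧-distribʳ-xor; xor-∧-commutativeRing)
open import Data.Nat as ℕ using (ℕ; zero; suc; _^_; s≤s⁻¹)
open import Data.Nat.Properties as ℕ using (+-suc; m+n≤o⇒n≤o)
open import Data.Product using (_×_; _,_; proj₁; proj₂; Σ)
open import Data.Vec using (Vec; []; _∷_; map)
open import Data.Vec.Properties using (map-const; ∷-injectiveˡ; ∷-injectiveʳ)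
open import Data.Vec.Relation.Unary.All as All using (All; []; _∷_)
open import Data.Vec.Relation.Unary.All.Properties using (map⁺; map⁻)
open import Relation.Binary.PropositionalEquality
open import Algebra.Properties.CommutativeSemigroup
  (CommutativeRing.+-commutativeSemigroup xor-∧-commutativeRing)
  using () renaming (interchange to xor-interchange)

⊕-identityˡ : ∀ {n} (v : F2^ n) → zeroV n ⊕ v ≡ v
⊕-identityˡ []      = refl
⊕-identityˡ (a ∷ v) = cong (a ∷_) (⊕-identityˡ v)

dot-zeroʳ : ∀ {n} (s : F2^ n) → dot s (zeroV n) ≡ false
dot-zeroʳ []          = refl
dot-zeroʳ (true ∷ s)  = dot-zeroʳ s
dot-zeroʳ (false ∷ s) = dot-zeroʳ s

dot-⊕ˡ : ∀ {n} (s t x : F2^ n) → dot (s ⊕ t) x ≡ dot s x xor dot t x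
dot-⊕ˡ []      []      []      = refl
dot-⊕ˡ (a ∷ s) (b ∷ t) (c ∷ x) =
  trans (cong₂ _xor_ (∧-distribʳ-xor c a b) (dot-⊕ˡ s t x))
        (xor-interchange (a ∧ c) (b ∧ c) (dot s x) (dot t x))

dot-⊕ʳ : ∀ {n} (s x y : F2^ n) → dot s (x ⊕ y) ≡ dot s x xor dot s y
dot-⊕ʳ []      []      []      = refl
dot-⊕ʳ (a ∷ s) (b ∷ x) (c ∷ y) =
  trans (cong₂ _xor_ (∧-distribˡ-xor a b c) (dot-⊕ʳ s x y))
        (xor-interchange (a ∧ b) (a ∧ c) (dot s x) (dot s y))

dot-lincomb-≡false : ∀ {n m} (s : F2^ n) (cs : F2^ m) {bs : Vec (F2^ n) m} →
  All (λ b → dot s b ≡ false) bs → dot s (lincomb cs bs) ≡ false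
dot-lincomb-≡false s []       []       = dot-zeroʳ s
dot-lincomb-≡false s (c ∷ cs) {b ∷ bs} (sb≡0 ∷ sbs≡0) =
  trans (dot-⊕ʳ s (if c then b else zeroV _) (lincomb cs bs))
        (cong₂ _xor_ (scaled c) (dot-lincomb-≡false s cs sbs≡0))
  where
  scaled : ∀ c → dot s (if c then b else zeroV _) ≡ false
  scaled true  = sb≡0
  scaled false = dot-zeroʳ s

lincomb-map-∷ : ∀ {n m} (h : F2^ n → Bool) (cs : F2^ m) (bs : Vec (F2^ n) m) →
  lincomb cs (map (λ b → h b ∷ b) bs) ≡ dot cs (map h bs) ∷ lincomb cs bs
lincomb-map-∷ h []       []       = refl
lincomb-map-∷ h (c ∷ cs) (b ∷ bs) rewrite lincomb-map-∷ h cs bs with c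
... | true  = refl
... | false = refl

LinIndep-map-∷ : ∀ {n m} (h : F2^ n → Bool) (bs : Vec (F2^ n) m) →
  LinIndep bs → LinIndep (map (λ b → h b ∷ b) bs)
LinIndep-map-∷ h bs indep cs cs·bs≡0 =
  indep cs (∷-injectiveʳ (trans (sym (lincomb-map-∷ h cs bs)) cs·bs≡0))

lincomb-extend : ∀ {n m} (c : Bool) (cs : F2^ m) (bs : Vec (F2^ n) m) →
  lincomb (c ∷ cs) ((true ∷ zeroV n) ∷ map (false ∷_) bs) ≡ c ∷ lincomb cs bs
lincomb-extend c cs bs
  rewrite lincomb-map-∷ (λ _ → false) cs bs | map-const bs false | dot-zeroʳ cs with c
... | true  = cong (true ∷_) (⊕-identityˡ _)
... | false = cong (false ∷_) (⊕-identityˡ _)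

LinIndep-extend : ∀ {n m} (bs : Vec (F2^ n) m) →
  LinIndep bs → LinIndep ((true ∷ zeroV n) ∷ map (false ∷_) bs)
LinIndep-extend bs indep (c ∷ cs) eq =
  cong₂ _∷_ (∷-injectiveˡ eq′) (indep cs (∷-injectiveʳ eq′))
  where eq′ = trans (sym (lincomb-extend c cs bs)) eq

InKernel : ∀ {n k} → Vec (F2^ n) k → F2^ n → Set
InKernel ss b = All (λ s → dot s b ≡ false) ss

eliminate : ∀ {n} → F2^ n → F2^ (suc n) → F2^ n
eliminate t (false ∷ u) = u
eliminate t (true  ∷ u) = u ⊕ t

dot-eliminate : ∀ {n} (t : F2^ n) (u : F2^ (suc n)) {b : F2^ n} →
  dot (eliminate t u) b ≡ false → dot u (dot t b ∷ b) ≡ false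
dot-eliminate t (false ∷ u) ub≡0 = ub≡0
dot-eliminate t (true  ∷ u) {b} ub≡0 =
  trans (xor-comm (dot t b) (dot u b)) (trans (sym (dot-⊕ˡ u t b)) ub≡0)

-- One step of Gaussian elimination on the first coordinate: either no row involves it, so e₀
-- is in the kernel and kernel vectors extend by 0; or a pivot row t is removed, the remaining
-- rows are reduced by it, and kernel vectors of the reduced system extend by t·b.
data Reduction {n : ℕ} : ∀ {k} → Vec (F2^ (suc n)) k → Set where
  no-pivot : ∀ {k} {ss : Vec (F2^ (suc n)) k} (ts : Vec (F2^ n) k) →
    InKernel ss (true ∷ zeroV n) →
    (∀ {b} → InKernel ts b → InKernel ss (false ∷ b)) → Reduction ss
  pivot : ∀ {k} {ss : Vec (F2^ (suc n)) (suc k)} (ts : Vec (F2^ n) k) (lift : F2^ n → Bool) →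
    (∀ {b} → InKernel ts b → InKernel ss (lift b ∷ b)) → Reduction ss

reduce : ∀ {n k} (ss : Vec (F2^ (suc n)) k) → Reduction ss
reduce [] = no-pivot [] [] (λ _ → [])
reduce ((false ∷ t) ∷ ss) with reduce ss
... | no-pivot ts e∈ker lift∈ker =
  no-pivot (t ∷ ts) (dot-zeroʳ t ∷ e∈ker) λ { (tb≡0 ∷ b∈ker) → tb≡0 ∷ lift∈ker b∈ker }
... | pivot ts lift lift∈ker =
  pivot (t ∷ ts) lift λ { (tb≡0 ∷ b∈ker) → tb≡0 ∷ lift∈ker b∈ker }
reduce ((true ∷ t) ∷ ss) =
  pivot (map (eliminate t) ss) (dot t)
    λ {b} b∈ker → xor-same (dot t b) ∷ All.map (λ {u} → dot-eliminate t u) (map⁻ b∈ker)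

IndepInKernel : ∀ {n k} → Vec (F2^ n) k → ℕ → Set
IndepInKernel {n} ss d = Σ (Vec (F2^ n) d) λ bs → LinIndep bs × All (InKernel ss) bs

kernel-basis : ∀ n {k} (ss : Vec (F2^ n) k) d → k ℕ.+ d ℕ.≤ n → IndepInKernel ss d
kernel-basis n ss zero _ = [] , (λ { [] _ → refl }) , []
kernel-basis zero {k} ss (suc d) k+d<0 with m+n≤o⇒n≤o k k+d<0
... | ()
kernel-basis (suc n) {k} ss (suc d) k+d≤n with reduce ss
... | no-pivot ts e∈ker lift∈ker =
  let bs , indep , bs∈ker = kernel-basis n ts d (s≤s⁻¹ (subst (ℕ._≤ suc n) (+-suc k d) k+d≤n))
  in  (true ∷ zeroV n) ∷ map (false ∷_) bs , LinIndep-extend bs indep ,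
      e∈ker ∷ map⁺ (All.map lift∈ker bs∈ker)
... | pivot ts lift lift∈ker =
  let bs , indep , bs∈ker = kernel-basis n ts (suc d) (s≤s⁻¹ k+d≤n)
  in  map (λ b → lift b ∷ b) bs , LinIndep-map-∷ lift bs indep , map⁺ (All.map lift∈ker bs∈ker)

queries-translate : ∀ {n k m} (ss : Vec (F2^ n) k) (x : F2^ n) (cs : F2^ m) {bs : Vec (F2^ n) m} →
  All (InKernel ss) bs → queries ss (x ⊕ lincomb cs bs) ≡ queries ss x
queries-translate []       x cs _      = refl
queries-translate (s ∷ ss) x cs bs∈ker = cong₂ _∷_
  (trans (dot-⊕ʳ s x (lincomb cs _))
         (trans (cong (dot s x xor_) (dot-lincomb-≡false s cs (All.map All.head bs∈ker)))
                (xor-identityʳ (dot s x))))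
  (queries-translate ss x cs (All.map All.tail bs∈ker))

module Counting where

  open import Data.Integer as ℤ using (1ℤ)
  import Data.Integer.Properties as ℤ
  open import Data.Rational
    using (ℚ; _/_; _+_; _*_; _-_; _<_; _≤_; 0ℚ; 1ℚ; Positive; positive; nonNegative; toℚᵘ)
  open import Data.Rational.Properties hiding (_≟_)
  open import Data.Rational.Unnormalised as ℚᵘ using (mkℚᵘ; *≡*) renaming (_≃_ to _≃ᵘ_)
  import Data.Rational.Unnormalised.Properties as ℚᵘ
  open import Data.List using (List; []; _∷_; _++_; length; filter; foldr; concatMap)
  open import Level using (0ℓ)
  open import Relation.Binary using (tri<; tri≈; tri>)
  open import Relation.Nullary using (¬_; does; contradiction)
  open import Relation.Unary using (Pred; Decidable)
  open import Data.Rational.Solver using (module +-*-Solver)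
  open import Algebra.Properties.CommutativeSemigroup
    (CommutativeMonoid.commutativeSemigroup +-0-commutativeMonoid)
    using () renaming (interchange to +-interchange)
  open Distribution

  fromℕ : ℕ → ℚ
  fromℕ a = ℤ.+ a / 1

  toℚᵘ-fromℕ : ∀ a → toℚᵘ (fromℕ a) ≃ᵘ mkℚᵘ (ℤ.+ a) 0
  toℚᵘ-fromℕ a = toℚᵘ-fromℚᵘ (mkℚᵘ (ℤ.+ a) 0)

  fromℕ-+ : ∀ a b → fromℕ (a ℕ.+ b) ≡ fromℕ a + fromℕ b
  fromℕ-+ a b = toℚᵘ-injective (begin-equality
    toℚᵘ (fromℕ (a ℕ.+ b))              ≃⟨ toℚᵘ-fromℕ (a ℕ.+ b) ⟩
    mkℚᵘ (ℤ.+ (a ℕ.+ b)) 0              ≃⟨ *≡* (cong (ℤ._* 1ℤ) (sym (cong₂ ℤ._+_ (ℤ.*-identityʳ (ℤ.+ a))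
                                                                          (ℤ.*-identityʳ (ℤ.+ b))))) ⟩
    mkℚᵘ (ℤ.+ a) 0 ℚᵘ.+ mkℚᵘ (ℤ.+ b) 0  ≃⟨ ℚᵘ.+-cong (toℚᵘ-fromℕ a) (toℚᵘ-fromℕ b) ⟨
    toℚᵘ (fromℕ a) ℚᵘ.+ toℚᵘ (fromℕ b)  ≃⟨ toℚᵘ-homo-+ (fromℕ a) (fromℕ b) ⟨
    toℚᵘ (fromℕ a + fromℕ b)            ∎)
    where open ℚᵘ.≤-Reasoning

  fromℕ-pos : ∀ m .{{_ : ℕ.NonZero m}} → Positive (fromℕ m)
  fromℕ-pos m = normalize-pos m 1

  /-*-fromℕ : ∀ a m .{{_ : ℕ.NonZero m}} → (ℤ.+ a / m) * fromℕ m ≡ fromℕ a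
  /-*-fromℕ a m@(suc m-1) = toℚᵘ-injective (begin-equality
    toℚᵘ ((ℤ.+ a / m) * fromℕ m)          ≃⟨ toℚᵘ-homo-* (ℤ.+ a / m) (fromℕ m) ⟩
    toℚᵘ (ℤ.+ a / m) ℚᵘ.* toℚᵘ (fromℕ m)  ≃⟨ ℚᵘ.*-cong (toℚᵘ-fromℚᵘ (mkℚᵘ (ℤ.+ a) m-1)) (toℚᵘ-fromℕ m) ⟩
    mkℚᵘ (ℤ.+ a) m-1 ℚᵘ.* mkℚᵘ (ℤ.+ m) 0  ≃⟨ *≡* (trans (ℤ.*-identityʳ _)
                                                      (cong (ℤ.+ a ℤ.*_) (sym (ℤ.*-identityʳ _)))) ⟩
    mkℚᵘ (ℤ.+ a) 0                        ≃⟨ toℚᵘ-fromℕ a ⟨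
    toℚᵘ (fromℕ a)                        ∎)
    where open ℚᵘ.≤-Reasoning

  ∑ : ∀ {A : Set} → List A → (A → ℚ) → ℚ
  ∑ xs f = foldr (λ x r → f x + r) 0ℚ xs

  𝟙 : Bool → ℚ
  𝟙 b = if b then 1ℚ else 0ℚ

  𝟙-+-𝟙-not : ∀ b → 𝟙 b + 𝟙 (not b) ≡ 1ℚ
  𝟙-+-𝟙-not true  = refl
  𝟙-+-𝟙-not false = refl

  module _ {A : Set} where

    ∑-cong : ∀ (xs : List A) {f g : A → ℚ} → (∀ x → f x ≡ g x) → ∑ xs f ≡ ∑ xs g
    ∑-cong []       f≡g = refl
    ∑-cong (x ∷ xs) f≡g = cong₂ _+_ (f≡g x) (∑-cong xs f≡g)

    ∑-+ : ∀ (xs : List A) (f g : A → ℚ) → ∑ xs (λ x → f x + g x) ≡ ∑ xs f + ∑ xs g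
    ∑-+ []       f g = sym (+-identityˡ 0ℚ)
    ∑-+ (x ∷ xs) f g = trans (cong (f x + g x +_) (∑-+ xs f g)) (+-interchange (f x) (g x) _ _)

    ∑-*ˡ : ∀ (xs : List A) (c : ℚ) (f : A → ℚ) → ∑ xs (λ x → c * f x) ≡ c * ∑ xs f
    ∑-*ˡ []       c f = sym (*-zeroʳ c)
    ∑-*ˡ (x ∷ xs) c f = trans (cong (c * f x +_) (∑-*ˡ xs c f)) (sym (*-distribˡ-+ c (f x) _))

    ∑-const : ∀ (xs : List A) (c : ℚ) → ∑ xs (λ _ → c) ≡ fromℕ (length xs) * c
    ∑-const []       c = sym (*-zeroˡ c)
    ∑-const (x ∷ xs) c = begin
      c + ∑ xs (λ _ → c)                 ≡⟨ cong₂ _+_ (sym (*-identityˡ c)) (∑-const xs c) ⟩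
      1ℚ * c + fromℕ (length xs) * c     ≡⟨ *-distribʳ-+ c 1ℚ (fromℕ (length xs)) ⟨
      (1ℚ + fromℕ (length xs)) * c       ≡⟨ cong (_* c) (fromℕ-+ 1 (length xs)) ⟨
      fromℕ (suc (length xs)) * c        ∎
      where open ≡-Reasoning

    ∑-mono-≤ : ∀ (xs : List A) {f g : A → ℚ} → (∀ x → f x ≤ g x) → ∑ xs f ≤ ∑ xs g
    ∑-mono-≤ []       f≤g = ≤-refl
    ∑-mono-≤ (x ∷ xs) f≤g = +-mono-≤ (f≤g x) (∑-mono-≤ xs f≤g)

    ∑-mono-< : ∀ (xs : List A) → 0 ℕ.< length xs →
      {f g : A → ℚ} → (∀ x → f x < g x) → ∑ xs f < ∑ xs g
    ∑-mono-< (x ∷ xs) _ f<g = +-mono-<-≤ (f<g x) (∑-mono-≤ xs (λ y → <⇒≤ (f<g y)))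

    ∑-++ : ∀ (xs ys : List A) (f : A → ℚ) → ∑ (xs ++ ys) f ≡ ∑ xs f + ∑ ys f
    ∑-++ []       ys f = sym (+-identityˡ _)
    ∑-++ (x ∷ xs) ys f = trans (cong (f x +_) (∑-++ xs ys f)) (sym (+-assoc (f x) _ _))

    ∑-filter : ∀ {P : Pred A 0ℓ} (P? : Decidable P) (xs : List A) (f : A → ℚ) →
      ∑ (filter P? xs) f ≡ ∑ xs (λ x → f x * 𝟙 (does (P? x)))
    ∑-filter P? []       f = refl
    ∑-filter P? (x ∷ xs) f with does (P? x)
    ... | true  = cong₂ _+_ (sym (*-identityʳ (f x))) (∑-filter P? xs f)
    ... | false = trans (∑-filter P? xs f) (sym (trans (cong (_+ _) (*-zeroʳ (f x))) (+-identityˡ _)))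

    length-filter : ∀ {P : Pred A 0ℓ} (P? : Decidable P) (xs : List A) →
      fromℕ (length (filter P? xs)) ≡ ∑ xs (λ x → 𝟙 (does (P? x)))
    length-filter P? []       = refl
    length-filter P? (x ∷ xs) with does (P? x)
    ... | true  = trans (fromℕ-+ 1 (length (filter P? xs))) (cong (1ℚ +_) (length-filter P? xs))
    ... | false = trans (length-filter P? xs) (sym (+-identityˡ _))

  ∑-concatMap : ∀ {A B : Set} (h : A → List B) (xs : List A) (f : B → ℚ) →
    ∑ (concatMap h xs) f ≡ ∑ xs (λ x → ∑ (h x) f)
  ∑-concatMap h []       f = refl
  ∑-concatMap h (x ∷ xs) f =
    trans (∑-++ (h x) (concatMap h xs) f) (cong (∑ (h x) f +_) (∑-concatMap h xs f))

  ∑-swap : ∀ {A B : Set} (xs : List A) (ys : List B) (f : A → B → ℚ) →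
    ∑ xs (λ x → ∑ ys (f x)) ≡ ∑ ys (λ y → ∑ xs (λ x → f x y))
  ∑-swap []       ys f = sym (trans (∑-const ys 0ℚ) (*-zeroʳ (fromℕ (length ys))))
  ∑-swap (x ∷ xs) ys f =
    trans (cong (∑ ys (f x) +_) (∑-swap xs ys f)) (sym (∑-+ ys (f x) (λ y → ∑ xs (λ x′ → f x′ y))))

  weightedSum : ∀ {A : Set} → List (ℚ × A) → (A → ℚ) → ℚ
  weightedSum L E = ∑ L (λ p → proj₁ p * E (proj₂ p))

  module _ {A : Set} {E : A → ℚ} {c : ℚ} where

    weightedSum-≥ : ∀ (L : List (ℚ × A)) → AllNonneg L → (∀ a → c ≤ E a) →
      c * totalWeight L ≤ weightedSum L E
    weightedSum-≥ []            []           c≤E = ≤-reflexive (*-zeroʳ c)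
    weightedSum-≥ ((w , a) ∷ L) (0≤w ∷ 0≤L) c≤E = begin
      c * (w + totalWeight L)         ≡⟨ *-distribˡ-+ c w _ ⟩
      c * w + c * totalWeight L       ≡⟨ cong (_+ c * totalWeight L) (*-comm c w) ⟩
      w * c + c * totalWeight L       ≤⟨ +-mono-≤ (*-monoˡ-≤-nonNeg w {{nonNegative 0≤w}} (c≤E a))
                                                  (weightedSum-≥ L 0≤L c≤E) ⟩
      w * E a + weightedSum L E       ∎
      where open ≤-Reasoning

    -- Strictness needs one positive weight: skip the zero weights until it is found.
    weightedSum-> : ∀ (L : List (ℚ × A)) → AllNonneg L → 0ℚ < totalWeight L → (∀ a → c < E a) →
      c * totalWeight L < weightedSum L E
    weightedSum-> []            []           0<0 c<E = contradiction 0<0 (<-irrefl refl)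
    weightedSum-> ((w , a) ∷ L) (0≤w ∷ 0≤L) 0<W c<E with <-cmp 0ℚ w
    ... | tri< 0<w _ _ = begin-strict
      c * (w + totalWeight L)         ≡⟨ *-distribˡ-+ c w _ ⟩
      c * w + c * totalWeight L       ≡⟨ cong (_+ c * totalWeight L) (*-comm c w) ⟩
      w * c + c * totalWeight L       <⟨ +-mono-<-≤ (*-monoʳ-<-pos w {{positive 0<w}} (c<E a))
                                                    (weightedSum-≥ L 0≤L (λ a → <⇒≤ (c<E a))) ⟩
      w * E a + weightedSum L E       ∎
      where open ≤-Reasoning
    ... | tri≈ _ refl _ = begin-strict
      c * (0ℚ + totalWeight L)        ≡⟨ cong (c *_) (+-identityˡ _) ⟩
      c * totalWeight L               <⟨ weightedSum-> L 0≤L 0<W′ c<E ⟩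
      weightedSum L E                 ≡⟨ +-identityˡ _ ⟨
      0ℚ + weightedSum L E            ≡⟨ cong (_+ weightedSum L E) (*-zeroˡ (E a)) ⟨
      0ℚ * E a + weightedSum L E      ∎
      where
      open ≤-Reasoning
      0<W′ = <-≤-trans 0<W (≤-reflexive (+-identityˡ (totalWeight L)))
    ... | tri> _ _ w<0 = contradiction (<-≤-trans w<0 0≤w) (<-irrefl refl)

  allVecs-length : ∀ n → length (allVecs n) ≡ 2 ^ n
  allVecs-length zero    = refl
  allVecs-length (suc n) = trans (length-doubled (allVecs n)) (cong (2 ℕ.*_) (allVecs-length n))
    where
    length-doubled : ∀ (xs : List (F2^ n)) →
      length (concatMap (λ v → (false ∷ v) ∷ (true ∷ v) ∷ []) xs) ≡ 2 ℕ.* length xs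
    length-doubled []       = refl
    length-doubled (x ∷ xs) = trans (cong (2 ℕ.+_) (length-doubled xs)) (sym (ℕ.*-suc 2 (length xs)))

  allVecs-nonempty : ∀ n → 0 ℕ.< length (allVecs n)
  allVecs-nonempty n = subst (0 ℕ.<_) (sym (allVecs-length n)) (ℕ.m^n>0 2 n)

  ∑-allVecs-const : ∀ n c → ∑ (allVecs n) (λ _ → c) ≡ fromℕ (2 ^ n) * c
  ∑-allVecs-const n c = trans (∑-const (allVecs n) c) (cong (λ m → fromℕ m * c) (allVecs-length n))

  ∑-allVecs-suc : ∀ n (F : F2^ (suc n) → ℚ) →
    ∑ (allVecs (suc n)) F ≡ ∑ (allVecs n) (λ u → F (false ∷ u) + F (true ∷ u))
  ∑-allVecs-suc n F = trans (∑-concatMap _ (allVecs n) F)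
    (∑-cong (allVecs n) λ u → cong (F (false ∷ u) +_) (+-identityʳ (F (true ∷ u))))

  ∑-allVecs-translate : ∀ n (F : F2^ n → ℚ) (v : F2^ n) →
    ∑ (allVecs n) (λ x → F (x ⊕ v)) ≡ ∑ (allVecs n) F
  ∑-allVecs-translate zero    F []      = refl
  ∑-allVecs-translate (suc n) F (a ∷ v) = begin
    ∑ (allVecs (suc n)) (λ x → F (x ⊕ (a ∷ v)))
      ≡⟨ ∑-allVecs-suc n (λ x → F (x ⊕ (a ∷ v))) ⟩
    ∑ (allVecs n) (λ u → F (a ∷ (u ⊕ v)) + F (not a ∷ (u ⊕ v)))
      ≡⟨ ∑-allVecs-translate n (λ u → F (a ∷ u) + F (not a ∷ u)) v ⟩
    ∑ (allVecs n) (λ u → F (a ∷ u) + F (not a ∷ u))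
      ≡⟨ ∑-cong (allVecs n) (both-heads a) ⟩
    ∑ (allVecs n) (λ u → F (false ∷ u) + F (true ∷ u))
      ≡⟨ ∑-allVecs-suc n F ⟨
    ∑ (allVecs (suc n)) F ∎
    where
    open ≡-Reasoning
    both-heads : ∀ a u → F (a ∷ u) + F (not a ∷ u) ≡ F (false ∷ u) + F (true ∷ u)
    both-heads false u = refl
    both-heads true  u = +-comm (F (true ∷ u)) (F (false ∷ u))

  does-≟-not : ∀ a b → does (a ≟ not b) ≡ not (does (b ≟ a))
  does-≟-not true  true  = refl
  does-≟-not true  false = refl
  does-≟-not false true  = refl
  does-≟-not false false = refl

  module _ {n k : ℕ} (f : F2^ n → Bool) (g : F2^ k → Bool) where

    err : Vec (F2^ n) k → F2^ n → ℚ
    err ss x = 𝟙 (not (does (g (queries ss x) ≟ f x)))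

    errors : Vec (F2^ n) k → ℚ
    errors ss = ∑ (allVecs n) (err ss)

    errorProb : Distribution n k → F2^ n → ℚ
    errorProb D x = ∑ (support D) (λ p → proj₁ p * err (proj₂ p) x)

    -- The queries, hence the answer of g, are constant on the coset x + ⟨bs⟩.
    coset-errors : ∀ {δ d} → AffineExtractor δ d f → (ss : Vec (F2^ n) k) {bs : Vec (F2^ n) d} →
      LinIndep bs → All (InKernel ss) bs → ∀ x →
      δ * fromℕ (2 ^ d) < ∑ (allVecs d) (λ c → err ss (x ⊕ lincomb c bs))
    coset-errors {δ} {d} ext ss {bs} indep bs∈ker x = begin-strict
      δ * fromℕ (2 ^ d)
        <⟨ *-monoˡ-<-pos _ {{2^d-pos}} (ext d ℕ.≤-refl A z) ⟩
      prUniform A f z * fromℕ (2 ^ d)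
        ≡⟨ /-*-fromℕ hits (2 ^ d) {{ℕ.m^n≢0 2 d}} ⟩
      fromℕ hits
        ≡⟨ length-filter (λ c → f (point c) ≟ z) (allVecs d) ⟩
      ∑ (allVecs d) (λ c → 𝟙 (does (f (point c) ≟ z)))
        ≡⟨ ∑-cong (allVecs d) (λ c → cong 𝟙 (wrong-answer c)) ⟩
      ∑ (allVecs d) (λ c → err ss (point c)) ∎
      where
      open ≤-Reasoning
      A = affine x bs indep
      point = AffineSubspace.point A
      z = not (g (queries ss x))
      hits = length (filter (λ c → f (point c) ≟ z) (allVecs d))
      2^d-pos = fromℕ-pos (2 ^ d) {{ℕ.m^n≢0 2 d}}
      wrong-answer : ∀ c → does (f (point c) ≟ z) ≡ not (does (g (queries ss (point c)) ≟ f (point c)))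
      wrong-answer c = trans (does-≟-not (f (point c)) (g (queries ss x)))
        (cong (λ q → not (does (g q ≟ f (point c)))) (sym (queries-translate ss x c bs∈ker)))

    -- Double counting over the cosets x + ⟨bs⟩ of a d-dimensional subspace of the kernel.
    errors-> : ∀ {δ d} → AffineExtractor δ d f → k ℕ.+ d ℕ.≤ n → ∀ ss → δ * fromℕ (2 ^ n) < errors ss
    errors-> {δ} {d} ext k+d≤n ss with kernel-basis n ss d k+d≤n
    ... | bs , indep , bs∈ker = *-cancelˡ-<-nonNeg K {{pos⇒nonNeg K {{K-pos}}}} (begin-strict
      K * (δ * N)
        ≡⟨ rearrange K δ N ⟩
      N * (δ * K)
        ≡⟨ ∑-allVecs-const n (δ * K) ⟨
      ∑ (allVecs n) (λ _ → δ * K)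
        <⟨ ∑-mono-< (allVecs n) (allVecs-nonempty n) (coset-errors ext ss indep bs∈ker) ⟩
      ∑ (allVecs n) (λ x → ∑ (allVecs d) (λ c → err ss (x ⊕ lincomb c bs)))
        ≡⟨ ∑-swap (allVecs n) (allVecs d) (λ x c → err ss (x ⊕ lincomb c bs)) ⟩
      ∑ (allVecs d) (λ c → ∑ (allVecs n) (λ x → err ss (x ⊕ lincomb c bs)))
        ≡⟨ ∑-cong (allVecs d) (λ c → ∑-allVecs-translate n (err ss) (lincomb c bs)) ⟩
      ∑ (allVecs d) (λ _ → errors ss)
        ≡⟨ ∑-allVecs-const d (errors ss) ⟩
      K * errors ss ∎)
      where
      open ≤-Reasoning
      K = fromℕ (2 ^ d)
      N = fromℕ (2 ^ n)
      K-pos = fromℕ-pos (2 ^ d) {{ℕ.m^n≢0 2 d}}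
      rearrange : ∀ K δ N → K * (δ * N) ≡ N * (δ * K)
      rearrange = solve 3 (λ K δ N → K :* (δ :* N) := N :* (δ :* K)) refl
        where open +-*-Solver

    weightedSum-errors : ∀ D → weightedSum (support D) errors ≡ ∑ (allVecs n) (errorProb D)
    weightedSum-errors D = trans
      (∑-cong (support D) (λ p → sym (∑-*ˡ (allVecs n) (proj₁ p) (err (proj₂ p)))))
      (∑-swap (support D) (allVecs n) (λ p x → proj₁ p * err (proj₂ p) x))

    success+error≡1 : ∀ D x → successProb D g f x + errorProb D x ≡ 1ℚ
    success+error≡1 D x = begin
      successProb D g f x + errorProb D x
        ≡⟨ cong (_+ errorProb D x) (∑-filter right (support D) proj₁) ⟩
      ∑ (support D) (λ p → proj₁ p * 𝟙 (ok p)) + errorProb D x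
        ≡⟨ ∑-+ (support D) (λ p → proj₁ p * 𝟙 (ok p)) (λ p → proj₁ p * 𝟙 (not (ok p))) ⟨
      ∑ (support D) (λ p → proj₁ p * 𝟙 (ok p) + proj₁ p * 𝟙 (not (ok p)))
        ≡⟨ ∑-cong (support D) (λ p → weight (proj₁ p) (ok p)) ⟩
      totalWeight (support D)
        ≡⟨ sumToOne D ⟩
      1ℚ ∎
      where
      open ≡-Reasoning
      right = λ (p : ℚ × Vec (F2^ n) k) → g (queries (proj₂ p) x) ≟ f x
      ok = λ p → does (right p)
      weight : ∀ w b → w * 𝟙 b + w * 𝟙 (not b) ≡ w
      weight w b = trans (sym (*-distribˡ-+ w (𝟙 b) (𝟙 (not b))))
                         (trans (cong (w *_) (𝟙-+-𝟙-not b)) (*-identityʳ w))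

    errorProb-≤ : ∀ {δ} D → (∀ x → 1ℚ - δ ≤ successProb D g f x) → ∀ x → errorProb D x ≤ δ
    errorProb-≤ {δ} D correct x = begin
      errorProb D x             ≡⟨ cancel (successProb D g f x) (errorProb D x) ⟩
      (S + errorProb D x) - S   ≡⟨ cong (_- S) (success+error≡1 D x) ⟩
      1ℚ - S                    ≤⟨ +-monoʳ-≤ 1ℚ (neg-antimono-≤ (correct x)) ⟩
      1ℚ - (1ℚ - δ)             ≡⟨ double-neg δ ⟩
      δ                         ∎
      where
      open ≤-Reasoning
      S = successProb D g f x
      cancel : ∀ a b → b ≡ (a + b) - a
      cancel = solve 2 (λ a b → b := (a :+ b) :- a) refl
        where open +-*-Solver
      double-neg : ∀ d → 1ℚ - (1ℚ - d) ≡ d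
      double-neg = solve 1 (λ d → con 1ℚ :- (con 1ℚ :- d) := d) refl
        where open +-*-Solver

  no-protocol : ∀ {n d k δ} {f : F2^ n → Bool} →
    AffineExtractor δ d f → k ℕ.+ d ℕ.≤ n → ¬ HasLinProtocol δ f k
  no-protocol {n} {δ = δ} {f} ext k+d≤n (D , g , correct) = <-irrefl refl (begin-strict
    δ * N                                ≡⟨ *-identityʳ (δ * N) ⟨
    δ * N * 1ℚ                           ≡⟨ cong (δ * N *_) (sumToOne D) ⟨
    δ * N * totalWeight (support D)      <⟨ weightedSum-> (support D) (nonneg D) 0<total
                                                             (errors-> f g ext k+d≤n) ⟩
    weightedSum (support D) (errors f g) ≡⟨ weightedSum-errors f g D ⟩
    ∑ (allVecs n) (errorProb f g D)      ≤⟨ ∑-mono-≤ (allVecs n) (errorProb-≤ f g {δ} D correct) ⟩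
    ∑ (allVecs n) (λ _ → δ)              ≡⟨ ∑-allVecs-const n δ ⟩
    N * δ                                ≡⟨ *-comm N δ ⟩
    δ * N                                ∎)
    where
    open ≤-Reasoning
    N = fromℕ (2 ^ n)
    0<total = <-≤-trans (positive⁻¹ 1ℚ) (≤-reflexive (sym (sumToOne D)))

open Counting using (no-protocol)
open import Data.Nat using (_+_; _≤_; _≤?_)
open import Data.Rational using (ℚ)
open import Relation.Nullary using (yes; no; contradiction)

lemmaB2 : (n d : ℕ) (δ : ℚ) (f : F2^ n → Bool) →
    AffineExtractor δ d f →
    ∀ k → HasLinProtocol δ f k → n + 1 ≤ k + d
lemmaB2 n d δ f ext k protocol with k + d ≤? n
... | yes k+d≤n = contradiction protocol (no-protocol ext k+d≤n)
... | no  k+d≰n = subst (_≤ k + d) (ℕ.+-comm 1 n) (ℕ.≰⇒> k+d≰n)
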